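{- Let $a,b\ge 2$ be integers such that $\mathrm{b}(a,b)$ is defined. Then $\mathrm{b}(a,b)\ge\lceil\log_b(a+2)\rceil+1$.
   Context: $\mathrm{b}(a,b)$ denotes the base size (smallest cardinality of a subset whose pointwise stabilizer is trivial) of $\mathrm{Sym}(ab)$ acting on the set of partitions of $\{1,\ldots,ab\}$ into $b$ parts each of cardinality $a$. It is defined whenever this action is faithful (for $a,b\ge 2$ this fails only for $a=b=2$). -}

module Defs where

open import Data.Nat using (ℕ; _*_; _^_; _≤_)
open import Data.Fin using (Fin; _≟_)
open import Data.Fin.Permutation using (Permutation′; _⟨$⟩ʳ_)
open import Data.List using (List; length; filter; allFin)
open import Data.Product using (Σ; _×_)
open import Function.Bundles using (_⇔_)
open import Relation.Binary.PropositionalEquality using (_≡_)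

-- A partition of Fin (a * b) into b parts each of cardinality a is
-- presented by a block-labelling f : Fin (a * b) → Fin b all of whose
-- fibres have exactly a elements.  (Different labellings with the same
-- kernel present the same partition; see _fixes_ below.)
record Partition (a b : ℕ) : Set where
  field
    label  : Fin (a * b) → Fin b
    fibres : ∀ (j : Fin b) → length (filter (λ i → label i ≟ j) (allFin (a * b))) ≡ a
open Partition public

-- σ fixes the partition P (as a point of the action of Sym(ab) on such
-- partitions) iff σ maps every block of P onto a block of P, i.e. iff
-- i, j lie in a common block exactly when σ i, σ j do.
_fixes_ : ∀ {a b} → Permutation′ (a * b) → Partition a b → Set
σ fixes P = ∀ i j → (label P i ≡ label P j) ⇔ (label P (σ ⟨$⟩ʳ i) ≡ label P (σ ⟨$⟩ʳ j))

IsIdentity : ∀ {n} → Permutation′ n → Set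
IsIdentity σ = ∀ i → σ ⟨$⟩ʳ i ≡ i

Faithful : ℕ → ℕ → Set
Faithful a b = ∀ (σ : Permutation′ (a * b)) → (∀ (P : Partition a b) → σ fixes P) → IsIdentity σ

IsBase : ∀ {a b k} → (Fin k → Partition a b) → Set
IsBase {a} {b} B = ∀ (σ : Permutation′ (a * b)) → (∀ t → σ fixes B t) → IsIdentity σ

IsCeilLog : ℕ → ℕ → ℕ → Set
IsCeilLog b n c = (n ≤ b ^ c) × (∀ m → n ≤ b ^ m → c ≤ m)

-- Give each point of {1,…,ab} its signature, the vector of its block labels in the
-- k = m + 1 partitions of a base. If two points had the same signature, their
-- transposition would fix every partition, so signatures are injective. Fix a
-- coordinate t and a label j: the a points of block j of partition t have distinct
-- signatures with j at t, so among the b^m words with j at t exactly b^m − a are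
-- missing. Suppose b^m ≤ a + 1. Then no slice {w | w t ≡ j} contains two missing
-- words. Take words c, c' with c 0 ≢ c' 0 that are missing (arbitrary if nothing is
-- missing). Swapping the labels c t and c' t in every coordinate t permutes the
-- missing words, hence the occurring signatures, and so induces a permutation of the
-- points that maps blocks to blocks in every partition. It moves the points of block
-- c 0 of the first partition, contradicting the base property. Hence a + 2 ≤ b^m,
-- i.e. c ≤ m.
module Submission where

open import Defs
open import Data.Fin using (Fin; zero; suc; _≟_; punchIn; fromℕ<; funToFin; finToFun; combine; splitAt; join)
open import Data.Fin.Properties
  using (any?; all?; injective⇒≤; punchIn-punchOut; finToFun-funToFin; funToFin-finToFin; join-splitAt)
open import Data.Fin.Permutation using (Permutation′; _⟨$⟩ʳ_; permutation; transpose)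
import Data.Fin.Permutation.Components as PC
open import Data.List as List using (List; filter; allFin)
import Data.List.Membership.Setoid.Properties as Membershipₛ
open import Data.List.Membership.Propositional.Properties using (∈-filter⁺; ∈-filter⁻; ∈-lookup; ∈-allFin)
import Data.List.Relation.Unary.All as All
import Data.List.Relation.Unary.Any as Any
open import Data.List.Relation.Unary.AllPairs using (_∷_)
open import Data.List.Relation.Unary.Unique.Propositional using (Unique)
open import Data.List.Relation.Unary.Unique.Propositional.Properties using (filter⁺; allFin⁺)
open import Data.Nat using (ℕ; zero; suc; _+_; _*_; _^_; _≤_; _<_; s≤s; z≤n; _<?_)
open import Data.Nat.Properties using (+-comm; <⇒≱; ≮⇒≥; <⇒≤)
open import Data.Product using (∃; _×_; _,_; proj₁; proj₂)
open import Data.Sum using (inj₁; inj₂; [_,_])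
open import Data.Vec.Functional using (Vector; insertAt; removeAt)
open import Data.Vec.Functional.Properties using (insertAt-lookup; removeAt-insertAt)
open import Function using (_∘_; const; case_of_)
open import Function.Bundles using (mk⇔)
open import Function.Definitions using (Injective)
open import Relation.Binary.PropositionalEquality
  using (_≡_; _≢_; _≗_; refl; sym; trans; cong; cong₂; subst; setoid; module ≡-Reasoning)
open import Relation.Binary.PropositionalEquality.Properties using (subst-injective)
open import Relation.Nullary using (¬_; yes; no; ¬?; contradiction)
open import Relation.Nullary.Decidable using (decidable-stable)
open import Relation.Unary using (Decidable)

transpose-matchˡ : ∀ {n} {i j k : Fin n} → k ≡ i → PC.transpose i j k ≡ j
transpose-matchˡ {i = i} {k = k} k≡i with k ≟ i
... | yes _ = refl
... | no k≢i = contradiction k≡i k≢i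

transpose-matchʳ : ∀ {n} {i j k : Fin n} → k ≡ j → PC.transpose i j k ≡ i
transpose-matchʳ {i = i} {j} {k} k≡j with k ≟ i
... | yes k≡i = trans (sym k≡j) k≡i
... | no _ with k ≟ j
...   | yes _ = refl
...   | no k≢j = contradiction k≡j k≢j

transpose-other : ∀ {n} {i j k : Fin n} → k ≢ i → k ≢ j → PC.transpose i j k ≡ k
transpose-other {i = i} {j} {k} k≢i k≢j with k ≟ i
... | yes k≡i = contradiction k≡i k≢i
... | no _ with k ≟ j
...   | yes k≡j = contradiction k≡j k≢j
...   | no _ = refl

-- A 'with' on k ≟ i would also rewrite the inner transposition, hence 'case'.
transpose-involutive : ∀ {n} {i j k : Fin n} → PC.transpose i j (PC.transpose i j k) ≡ k
transpose-involutive {i = i} {j} {k} = case k ≟ i of λ where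
  (yes k≡i) → trans (cong (PC.transpose i j) (transpose-matchˡ k≡i))
                    (trans (transpose-matchʳ {k = j} refl) (sym k≡i))
  (no k≢i) → case k ≟ j of λ where
    (yes k≡j) → trans (cong (PC.transpose i j) (transpose-matchʳ k≡j))
                      (trans (transpose-matchˡ {k = i} refl) (sym k≡j))
    (no k≢j) → trans (cong (PC.transpose i j) (transpose-other k≢i k≢j)) (transpose-other k≢i k≢j)

transpose-injective : ∀ {n} (i j : Fin n) → Injective _≡_ _≡_ (PC.transpose i j)
transpose-injective i j eq =
  trans (sym transpose-involutive) (trans (cong (PC.transpose i j) eq) transpose-involutive)

transpose-invariant : ∀ {n} {A : Set} (f : Fin n → A) {i j : Fin n} →
                      f i ≡ f j → ∀ k → f (PC.transpose i j k) ≡ f k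
transpose-invariant f {i} {j} fi≡fj k with k ≟ i
... | yes refl = sym fi≡fj
... | no _ with k ≟ j
...   | yes refl = fi≡fj
...   | no _ = refl

disjoint-injections⇒+≤ : ∀ {r m n} {g : Fin r → Fin n} {f : Fin m → Fin n} →
                         Injective _≡_ _≡_ g → Injective _≡_ _≡_ f → (∀ x y → g x ≢ f y) → r + m ≤ n
disjoint-injections⇒+≤ {r} {m} {g = g} {f} g-inj f-inj g≢f =
  injective⇒≤ {f = [ g , f ] ∘ splitAt r} λ {x} {y} eq →
    trans (sym (join-splitAt r m x))
          (trans (cong (join r m) (copair-injective (splitAt r x) (splitAt r y) eq)) (join-splitAt r m y))
  where
  copair-injective : ∀ u v → [ g , f ] u ≡ [ g , f ] v → u ≡ v
  copair-injective (inj₁ x) (inj₁ y) eq = cong inj₁ (g-inj eq)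
  copair-injective (inj₁ x) (inj₂ y) eq = contradiction eq (g≢f x y)
  copair-injective (inj₂ x) (inj₁ y) eq = contradiction (sym eq) (g≢f y x)
  copair-injective (inj₂ x) (inj₂ y) eq = cong inj₂ (f-inj eq)

funToFin-cong : ∀ {m n} {u v : Vector (Fin n) m} → u ≗ v → funToFin u ≡ funToFin v
funToFin-cong {zero} _ = refl
funToFin-cong {suc m} u≗v = cong₂ combine (u≗v zero) (funToFin-cong (u≗v ∘ suc))

funToFin-injective : ∀ {m n} {u v : Vector (Fin n) m} → funToFin u ≡ funToFin v → u ≗ v
funToFin-injective {u = u} {v} eq t =
  trans (sym (finToFun-funToFin u t)) (trans (cong (λ w → finToFun w t) eq) (finToFun-funToFin v t))

finToFun-injective : ∀ {m n} {w w' : Fin (n ^ m)} → finToFun {n} {m} w ≗ finToFun w' → w ≡ w'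
finToFun-injective {m} {n} {w} {w'} eq =
  trans (sym (funToFin-finToFin {m} {n} w)) (trans (funToFin-cong {m} {n} eq) (funToFin-finToFin {m} {n} w'))

≗-removeAt : ∀ {A : Set} {m} {u v : Vector A (suc m)} t → u t ≡ v t → removeAt u t ≗ removeAt v t → u ≗ v
≗-removeAt {u = u} {v} t uₜ≡vₜ eq s with t ≟ s
... | yes refl = uₜ≡vₜ
... | no t≢s = trans (cong u (sym t↑s)) (trans (eq _) (cong v t↑s))
  where t↑s = punchIn-punchOut t≢s

lookup-injective : ∀ {A : Set} {xs : List A} → Unique xs → Injective _≡_ _≡_ (List.lookup xs)
lookup-injective (_ ∷ _) {zero} {zero} _ = refl
lookup-injective (x∉xs ∷ _) {zero} {suc y} eq = contradiction eq (All.lookup x∉xs (∈-lookup y))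
lookup-injective (x∉xs ∷ _) {suc x} {zero} eq = contradiction (sym eq) (All.lookup x∉xs (∈-lookup x))
lookup-injective (_ ∷ xs!) {suc x} {suc y} eq = cong suc (lookup-injective xs! eq)

module Block {a b} (P : Partition a b) (j : Fin b) where
  private
    inBlock? : Decidable (λ i → label P i ≡ j)
    inBlock? i = label P i ≟ j

    members : List (Fin (a * b))
    members = filter inBlock? (allFin (a * b))

  member : Fin a → Fin (a * b)
  member x = List.lookup members (subst Fin (sym (fibres P j)) x)

  member-injective : Injective _≡_ _≡_ member
  member-injective eq =
    subst-injective (sym (fibres P j)) (lookup-injective (filter⁺ inBlock? (allFin⁺ (a * b))) eq)

  label-member : ∀ x → label P (member x) ≡ j
  label-member x = proj₂ (∈-filter⁻ inBlock? {xs = allFin (a * b)} (∈-lookup _))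

  position : ∀ {i} → label P i ≡ j → Fin a
  position {i} i∈P = subst Fin (fibres P j) (Any.index (∈-filter⁺ inBlock? (∈-allFin i) i∈P))

  position-injective : ∀ {i i'} (i∈P : label P i ≡ j) (i'∈P : label P i' ≡ j) →
                       position i∈P ≡ position i'∈P → i ≡ i'
  position-injective i∈P i'∈P eq =
    Membershipₛ.index-injective (setoid _)
      (∈-filter⁺ inBlock? (∈-allFin _) i∈P) (∈-filter⁺ inBlock? (∈-allFin _) i'∈P)
      (subst-injective (fibres P j) eq)

relabelling-fixes : ∀ {a b} (P : Partition a b) (σ : Permutation′ (a * b)) {h : Fin b → Fin b} →
                    Injective _≡_ _≡_ h → (∀ i → label P (σ ⟨$⟩ʳ i) ≡ h (label P i)) → σ fixes P
relabelling-fixes P σ {h} h-inj relabel i j = mk⇔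
  (λ eq → trans (relabel i) (trans (cong h eq) (sym (relabel j))))
  (λ eq → h-inj (trans (sym (relabel i)) (trans eq (relabel j))))

swapCoordinates : ∀ {b k} → Vector (Fin b) k → Vector (Fin b) k → Vector (Fin b) k → Vector (Fin b) k
swapCoordinates c c' w t = PC.transpose (c t) (c' t) (w t)

module Signatures {a b k} (B : Fin k → Partition a b) where
  signature : Fin (a * b) → Vector (Fin b) k
  signature i t = label (B t) i

  Occurs : Vector (Fin b) k → Set
  Occurs w = ∃ λ i → signature i ≗ w

  Missing : Vector (Fin b) k → Set
  Missing w = ¬ Occurs w

  occurs? : Decidable Occurs
  occurs? w = any? λ i → all? λ t → signature i t ≟ w t

  occurs-resp : ∀ {w w'} → w ≗ w' → Occurs w → Occurs w'
  occurs-resp w≗w' (i , eq) = i , λ t → trans (eq t) (w≗w' t)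

  module _ (isBase : IsBase B) where
    signature-injective : ∀ {i i'} → signature i ≗ signature i' → i ≡ i'
    signature-injective {i} {i'} same =
      sym (trans (sym (transpose-matchˡ {i = i} {i'} {i} refl)) (isBase (transpose i i') swap-fixes i))
      where
      swap-fixes : ∀ t → transpose i i' fixes B t
      swap-fixes t = relabelling-fixes (B t) (transpose i i') (λ eq → eq)
                                       (transpose-invariant (label (B t)) (same t))

    swap-preserving-missing⇒fixes-signatures :
      ∀ c c' → (∀ w → Missing w → Missing (swapCoordinates c c' w)) →
      ∀ i → swapCoordinates c c' (signature i) ≗ signature i
    swap-preserving-missing⇒fixes-signatures c c' preserves i t =
      trans (sym (signature-σ i t)) (cong (λ x → signature x t) (isBase σₚ σ-fixes i))
      where
      occurs-swap : ∀ i → Occurs (swapCoordinates c c' (signature i))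
      occurs-swap i = decidable-stable (occurs? _) λ missing →
        preserves _ missing (i , λ t → sym transpose-involutive)

      σ : Fin (a * b) → Fin (a * b)
      σ i = proj₁ (occurs-swap i)

      signature-σ : ∀ i → signature (σ i) ≗ swapCoordinates c c' (signature i)
      signature-σ i = proj₂ (occurs-swap i)

      σ-involutive : ∀ i → σ (σ i) ≡ i
      σ-involutive i = signature-injective λ t →
        trans (signature-σ (σ i) t)
              (trans (cong (PC.transpose (c t) (c' t)) (signature-σ i t)) transpose-involutive)

      σₚ : Permutation′ (a * b)
      σₚ = permutation σ σ σ-involutive σ-involutive

      σ-fixes : ∀ t → σₚ fixes B t
      σ-fixes t = relabelling-fixes (B t) σₚ (transpose-injective (c t) (c' t)) (λ i → signature-σ i t)

    swap-preserving-missing⇒trivial :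
      0 < a → ∀ c c' → (∀ w → Missing w → Missing (swapCoordinates c c' w)) → c ≗ c'
    swap-preserving-missing⇒trivial 0<a c c' preserves t =
      trans (sym (label-member x))
            (trans (sym (swap-preserving-missing⇒fixes-signatures c c' preserves (member x) t))
                   (transpose-matchˡ (label-member x)))
      where
      open Block (B t) (c t)
      x = fromℕ< 0<a

module Counting {a b m} (B : Fin (suc m) → Partition a b) (isBase : IsBase B) where
  open Signatures B

  private
    code : Fin (suc m) → Vector (Fin b) (suc m) → Fin (b ^ m)
    code t w = funToFin (removeAt w t)

    code-injective : ∀ t {w w'} → w t ≡ w' t → code t w ≡ code t w' → w ≗ w'
    code-injective t wₜ≡w'ₜ eq = ≗-removeAt t wₜ≡w'ₜ (funToFin-injective eq)

  distinct-missing⇒r+a≤b^m : ∀ {r} t j (g : Fin r → Vector (Fin b) (suc m)) →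
                             (∀ {x y} → g x ≗ g y → x ≡ y) → (∀ x → Missing (g x)) → (∀ x → g x t ≡ j) →
                             r + a ≤ b ^ m
  distinct-missing⇒r+a≤b^m t j g g-distinct g-missing g-slice =
    disjoint-injections⇒+≤ {g = code t ∘ g} {f = code t ∘ signature ∘ member}
      (λ {x} {y} eq → g-distinct (code-injective t (trans (g-slice x) (sym (g-slice y))) eq))
      (λ {x} {y} eq → member-injective (signature-injective isBase
                        (code-injective t (trans (label-member x) (sym (label-member y))) eq)))
      (λ y x eq → g-missing y (member x , code-injective t (trans (label-member x) (sym (g-slice y))) (sym eq)))
    where open Block (B t) j

  occurring-slice⇒b^m≤a : ∀ t j → (∀ u → Occurs (insertAt (finToFun u) t j)) → b ^ m ≤ a
  occurring-slice⇒b^m≤a t j occurs = injective⇒≤ {f = λ u → position (witness-label u)} λ {u} {u'} eq →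
    finToFun-injective λ s → begin
      finToFun u s                         ≡⟨ removeAt-insertAt (finToFun u) t j s ⟨
      word u (punchIn t s)                 ≡⟨ witness-signature u _ ⟨
      signature (witness u) (punchIn t s)  ≡⟨ cong (λ i → signature i (punchIn t s)) (position-injective _ _ eq) ⟩
      signature (witness u') (punchIn t s) ≡⟨ witness-signature u' _ ⟩
      word u' (punchIn t s)                ≡⟨ removeAt-insertAt (finToFun u') t j s ⟩
      finToFun u' s                        ∎
    where
    open Block (B t) j
    open ≡-Reasoning

    word : Fin (b ^ m) → Vector (Fin b) (suc m)
    word u = insertAt (finToFun u) t j

    witness : Fin (b ^ m) → Fin (a * b)
    witness u = proj₁ (occurs u)

    witness-signature : ∀ u → signature (witness u) ≗ word u
    witness-signature u = proj₂ (occurs u)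

    witness-label : ∀ u → label (B t) (witness u) ≡ j
    witness-label u = trans (witness-signature u t) (insertAt-lookup (finToFun u) t j)

  a<b^m⇒missing : a < b ^ m → ∀ t j → ∃ λ w → w t ≡ j × Missing w
  a<b^m⇒missing a<b^m t j with any? (λ u → ¬? (occurs? (insertAt (finToFun u) t j)))
  ... | yes (u , missing) = insertAt (finToFun u) t j , insertAt-lookup (finToFun u) t j , missing
  ... | no none = contradiction
        (occurring-slice⇒b^m≤a t j λ u → decidable-stable (occurs? _) (λ missing → none (u , missing)))
        (<⇒≱ a<b^m)

  b^m≤a⇒nothing-missing : b ^ m ≤ a → ∀ w → ¬ Missing w
  b^m≤a⇒nothing-missing b^m≤a w missing = contradiction b^m≤a (<⇒≱ 1+a≤b^m)
    where
    1+a≤b^m : 1 + a ≤ b ^ m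
    1+a≤b^m = distinct-missing⇒r+a≤b^m zero (w zero) (const w)
                (λ { {zero} {zero} _ → refl ; {zero} {suc ()} ; {suc ()} }) (const missing) (const refl)

  b^m≤1+a⇒missing-unique : b ^ m ≤ suc a → ∀ {w w'} t → Missing w → Missing w' → w t ≡ w' t → w ≗ w'
  b^m≤1+a⇒missing-unique b^m≤1+a {w} {w'} t missing missing' wₜ≡w'ₜ with all? (λ s → w s ≟ w' s)
  ... | yes w≗w' = w≗w'
  ... | no w≉w' = contradiction b^m≤1+a
        (<⇒≱ (distinct-missing⇒r+a≤b^m t (w t) pair pair-distinct pair-missing pair-slice))
    where
    pair : Fin 2 → Vector (Fin b) (suc m)
    pair zero = w
    pair (suc zero) = w'

    pair-distinct : ∀ {x y} → pair x ≗ pair y → x ≡ y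
    pair-distinct {zero} {zero} _ = refl
    pair-distinct {zero} {suc zero} w≗w' = contradiction w≗w' w≉w'
    pair-distinct {suc zero} {zero} w'≗w = contradiction (sym ∘ w'≗w) w≉w'
    pair-distinct {suc zero} {suc zero} _ = refl

    pair-missing : ∀ x → Missing (pair x)
    pair-missing zero = missing
    pair-missing (suc zero) = missing'

    pair-slice : ∀ x → pair x t ≡ w t
    pair-slice zero = refl
    pair-slice (suc zero) = sym wₜ≡w'ₜ

  b^m≤1+a⇒swap-preserves-missing : b ^ m ≤ suc a → ∀ {c c'} → Missing c → Missing c' →
                                   ∀ w → Missing w → Missing (swapCoordinates c c' w)
  b^m≤1+a⇒swap-preserves-missing b^m≤1+a {c} {c'} missing-c missing-c' w missing-w
    with all? (λ s → w s ≟ c s) | all? (λ s → w s ≟ c' s)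
  ... | yes w≗c | _ = missing-c' ∘ occurs-resp (λ t → transpose-matchˡ (w≗c t))
  ... | no _ | yes w≗c' = missing-c ∘ occurs-resp (λ t → transpose-matchʳ (w≗c' t))
  ... | no w≉c | no w≉c' = missing-w ∘ occurs-resp (λ t → transpose-other
        (w≉c ∘ b^m≤1+a⇒missing-unique b^m≤1+a t missing-w missing-c)
        (w≉c' ∘ b^m≤1+a⇒missing-unique b^m≤1+a t missing-w missing-c'))

base⇒a+2≤b^m : ∀ {a b m} (B : Fin (suc m) → Partition a b) → 1 ≤ a → 2 ≤ b → IsBase B → a + 2 ≤ b ^ m
base⇒a+2≤b^m {a} {suc (suc b)} {m} B 0<a (s≤s (s≤s z≤n)) isBase = case suc a <? suc (suc b) ^ m of λ where
    (yes 2+a≤b^m) → subst (_≤ suc (suc b) ^ m) (+-comm 2 a) 2+a≤b^m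
    (no 2+a≰b^m) → case a <? suc (suc b) ^ m of λ where
      (no a≮b^m) → contradiction
        (swap-preserving-missing⇒trivial isBase 0<a (const zero) (const (suc zero))
          (λ w missing → contradiction missing (b^m≤a⇒nothing-missing (≮⇒≥ a≮b^m) w)) zero)
        λ ()
      (yes a<b^m) →
        let (c , c₀≡0 , missing-c) = a<b^m⇒missing a<b^m zero zero
            (c' , c'₀≡1 , missing-c') = a<b^m⇒missing a<b^m zero (suc zero)
            c≗c' = swap-preserving-missing⇒trivial isBase 0<a c c'
                     (b^m≤1+a⇒swap-preserves-missing (≮⇒≥ 2+a≰b^m) missing-c missing-c')
        in contradiction (trans (sym c₀≡0) (trans (c≗c' zero) c'₀≡1)) λ ()
  where
  open Signatures B
  open Counting B isBase

no-empty-base : ∀ {a b} → 2 ≤ a → 2 ≤ b → (B : Fin 0 → Partition a b) → ¬ IsBase B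
no-empty-base (s≤s (s≤s z≤n)) (s≤s (s≤s z≤n)) B isBase =
  contradiction (signature-injective isBase {zero} {suc zero} λ ()) λ ()
  where open Signatures B

lemma3p1 : ∀ (a b : ℕ) → 2 ≤ a → 2 ≤ b → Faithful a b →
           ∀ (c : ℕ) → IsCeilLog b (a + 2) c →
           ∀ (k : ℕ) (B : Fin k → Partition a b) → IsBase B → suc c ≤ k
lemma3p1 a b 2≤a 2≤b _ _ _ zero B isBase = contradiction isBase (no-empty-base 2≤a 2≤b B)
lemma3p1 a b 2≤a 2≤b _ _ (_ , minimal) (suc m) B isBase =
  s≤s (minimal m (base⇒a+2≤b^m B (<⇒≤ 2≤a) 2≤b isBase))
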